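{- Let $\mathcal{C}$ be a cartesian closed category such that for all objects $A,B$ the canonical morphism $A\to A^{(B^A)}$ (the transpose of the projection $A\times B^A\to A$, i.e. $a\mapsto\lambda f.\,a$) is an isomorphism. Then $\mathcal{C}$ is posetal (any two parallel morphisms are equal). If moreover $\mathcal{C}$ is cocartesian (has finite coproducts), then $\mathcal{C}$ is a (possibly large) pre-Boolean algebra.
   Context: A pre-Boolean algebra is a preordered class (viewed as a category with at most one morphism between any two objects) whose quotient by the equivalence $a\sim b\iff(a\le b\text{ and }b\le a)$ is a Boolean algebra. -}

module Defs where

open import Level using (Level; _⊔_; suc)
open import Data.Product using (Σ; _×_; _,_)
open import Function.Bundles using (_⇔_)
open import Relation.Binary.Structures using (IsEquivalence)
open import Algebra.Lattice.Structures using (IsBooleanAlgebra)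

record Category (o ℓ e : Level) : Set (suc (o ⊔ ℓ ⊔ e)) where
  infixr 9 _∘_
  infix  4 _≈_
  infixr 5 _⇒_
  field
    Obj  : Set o
    _⇒_  : Obj → Obj → Set ℓ
    _≈_  : ∀ {A B} → (A ⇒ B) → (A ⇒ B) → Set e
    id   : ∀ {A} → A ⇒ A
    _∘_  : ∀ {A B C} → B ⇒ C → A ⇒ B → A ⇒ C
    equiv     : ∀ {A B} → IsEquivalence (_≈_ {A} {B})
    assoc     : ∀ {A B C D} {f : A ⇒ B} {g : B ⇒ C} {h : C ⇒ D} →
                (h ∘ g) ∘ f ≈ h ∘ (g ∘ f)
    identityˡ : ∀ {A B} {f : A ⇒ B} → id ∘ f ≈ f
    identityʳ : ∀ {A B} {f : A ⇒ B} → f ∘ id ≈ f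
    ∘-resp-≈  : ∀ {A B C} {f h : B ⇒ C} {g i : A ⇒ B} →
                f ≈ h → g ≈ i → f ∘ g ≈ h ∘ i

module _ {o ℓ e} (C : Category o ℓ e) where
  open Category C

  IsIso : ∀ {A B} → A ⇒ B → Set (ℓ ⊔ e)
  IsIso {A} {B} f = Σ (B ⇒ A) λ g → (g ∘ f ≈ id) × (f ∘ g ≈ id)

  Posetal : Set (o ⊔ ℓ ⊔ e)
  Posetal = ∀ {A B} (f g : A ⇒ B) → f ≈ g

  record CartesianClosed : Set (o ⊔ ℓ ⊔ e) where
    infixr 7 _×ₒ_
    infixr 6 _⇨_
    field
      ⊤ₒ       : Obj
      !        : ∀ {A} → A ⇒ ⊤ₒ
      !-unique : ∀ {A} (f : A ⇒ ⊤ₒ) → ! ≈ f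

      _×ₒ_     : Obj → Obj → Obj
      π₁       : ∀ {A B} → A ×ₒ B ⇒ A
      π₂       : ∀ {A B} → A ×ₒ B ⇒ B
      ⟨_,_⟩    : ∀ {X A B} → X ⇒ A → X ⇒ B → X ⇒ A ×ₒ B
      project₁ : ∀ {X A B} {f : X ⇒ A} {g : X ⇒ B} → π₁ ∘ ⟨ f , g ⟩ ≈ f
      project₂ : ∀ {X A B} {f : X ⇒ A} {g : X ⇒ B} → π₂ ∘ ⟨ f , g ⟩ ≈ g
      ×-unique : ∀ {X A B} {f : X ⇒ A} {g : X ⇒ B} {h : X ⇒ A ×ₒ B} →
                 π₁ ∘ h ≈ f → π₂ ∘ h ≈ g → ⟨ f , g ⟩ ≈ h

      -- A ⇨ B is the exponential B^A
      _⇨_      : Obj → Obj → Obj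
      eval     : ∀ {A B} → (A ⇨ B) ×ₒ A ⇒ B
      curry    : ∀ {X A B} → X ×ₒ A ⇒ B → X ⇒ A ⇨ B
      β        : ∀ {X A B} {g : X ×ₒ A ⇒ B} →
                 eval ∘ ⟨ curry g ∘ π₁ , id ∘ π₂ ⟩ ≈ g
      λ-unique : ∀ {X A B} {g : X ×ₒ A ⇒ B} {h : X ⇒ A ⇨ B} →
                 eval ∘ ⟨ h ∘ π₁ , id ∘ π₂ ⟩ ≈ g → h ≈ curry g

    canonical : ∀ (A B : Obj) → A ⇒ ((A ⇨ B) ⇨ A)
    canonical A B = curry π₁

  record Cocartesian : Set (o ⊔ ℓ ⊔ e) where
    infixr 6 _+ₒ_
    field
      ⊥ₒ       : Obj
      ¡        : ∀ {A} → ⊥ₒ ⇒ A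
      ¡-unique : ∀ {A} (f : ⊥ₒ ⇒ A) → ¡ ≈ f

      _+ₒ_     : Obj → Obj → Obj
      i₁       : ∀ {A B} → A ⇒ A +ₒ B
      i₂       : ∀ {A B} → B ⇒ A +ₒ B
      [_,_]    : ∀ {A B X} → A ⇒ X → B ⇒ X → A +ₒ B ⇒ X
      inject₁  : ∀ {A B X} {f : A ⇒ X} {g : B ⇒ X} → [ f , g ] ∘ i₁ ≈ f
      inject₂  : ∀ {A B X} {f : A ⇒ X} {g : B ⇒ X} → [ f , g ] ∘ i₂ ≈ g
      +-unique : ∀ {A B X} {f : A ⇒ X} {g : B ⇒ X} {h : A +ₒ B ⇒ X} →
                 h ∘ i₁ ≈ f → h ∘ i₂ ≈ g → [ f , g ] ≈ h

-- Pre-Boolean algebras: a preordered class whose quotient by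
-- a ~ b := a ≤ b × b ≤ a is a Boolean algebra.  The quotient is
-- represented as the carrier with equality _~_ (a setoid); the Boolean
-- algebra's lattice order must agree with the induced order.

module _ {o ℓ} {A : Set o} (_≤_ : A → A → Set ℓ) where

  _~_ : A → A → Set ℓ
  a ~ b = (a ≤ b) × (b ≤ a)

  record IsPreBooleanAlgebra : Set (o ⊔ ℓ) where
    field
      ≤-refl  : ∀ {a} → a ≤ a
      ≤-trans : ∀ {a b c} → a ≤ b → b ≤ c → a ≤ c
      _∨_ _∧_ : A → A → A
      ¬_      : A → A
      ⊤ ⊥     : A
      isBooleanAlgebra : IsBooleanAlgebra _~_ _∨_ _∧_ ¬_ ⊤ ⊥
      order   : ∀ a b → (a ≤ b) ⇔ ((a ∧ b) ~ a)

IsPreBooleanCategory : ∀ {o ℓ e} → Category o ℓ e → Set (o ⊔ ℓ)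
IsPreBooleanCategory C = IsPreBooleanAlgebra (Category._⇒_ C)

-- The canonical map A → A^(B^A) sends a to the constant function at a.
-- If it is onto, every element of A^(A^A) is constant; in particular the
-- evaluation functional φ ↦ φ a is, so φ a does not depend on φ, and
-- f = (const f) g = (const g) g = g for any f, g : Y → A.
-- With coproducts, the poset reflection is a distributive lattice (× has
-- a right adjoint, so it distributes over +), and a retraction of the
-- canonical map A → A^(¬A) is the law (¬A → A) → A, which with
-- A = X + ¬X turns the intuitionistic ¬¬(X + ¬X) into excluded middle.
module Submission where

open import Defs
open import Data.Product using (_×_; _,_; proj₁; proj₂)
open import Function.Bundles using (mk⇔)
open import Relation.Binary.Structures using (IsEquivalence)
open import Relation.Binary.Bundles using (Setoid)
import Relation.Binary.Reasoning.Setoid as SetoidReasoning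
import Algebra.Consequences.Setoid as Consequences
open import Algebra.Lattice.Structures using (IsLattice; IsDistributiveLattice)
open import Algebra.Lattice.Structures.Biased using (isBooleanAlgebraʳ)

module CartesianClosedProperties {o ℓ e} {C : Category o ℓ e} (ccc : CartesianClosed C) where
  open Category C
  open CartesianClosed ccc
  private module ≈ {A B} = IsEquivalence (equiv {A} {B})

  hom-setoid : Obj → Obj → Setoid ℓ e
  hom-setoid A B = record { Carrier = A ⇒ B ; _≈_ = _≈_ ; isEquivalence = equiv }

  ⟨⟩-cong : ∀ {X A B} {f f′ : X ⇒ A} {g g′ : X ⇒ B} →
            f ≈ f′ → g ≈ g′ → ⟨ f , g ⟩ ≈ ⟨ f′ , g′ ⟩
  ⟨⟩-cong f≈f′ g≈g′ =
    ×-unique (≈.trans project₁ (≈.sym f≈f′)) (≈.trans project₂ (≈.sym g≈g′))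

  ⟨⟩∘ : ∀ {W X A B} {f : X ⇒ A} {g : X ⇒ B} {h : W ⇒ X} →
        ⟨ f , g ⟩ ∘ h ≈ ⟨ f ∘ h , g ∘ h ⟩
  ⟨⟩∘ = ≈.sym (×-unique
    (≈.trans (≈.sym assoc) (∘-resp-≈ project₁ ≈.refl))
    (≈.trans (≈.sym assoc) (∘-resp-≈ project₂ ≈.refl)))

  ⁂∘⟨⟩ : ∀ {X A A′ B B′} {f : A ⇒ A′} {g : B ⇒ B′} {a : X ⇒ A} {b : X ⇒ B} →
         ⟨ f ∘ π₁ , g ∘ π₂ ⟩ ∘ ⟨ a , b ⟩ ≈ ⟨ f ∘ a , g ∘ b ⟩
  ⁂∘⟨⟩ = ≈.trans ⟨⟩∘ (⟨⟩-cong
    (≈.trans assoc (∘-resp-≈ ≈.refl project₁))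
    (≈.trans assoc (∘-resp-≈ ≈.refl project₂)))

  swap∘⟨⟩ : ∀ {X A B} {a : X ⇒ A} {b : X ⇒ B} → ⟨ π₂ , π₁ ⟩ ∘ ⟨ a , b ⟩ ≈ ⟨ b , a ⟩
  swap∘⟨⟩ = ≈.trans ⟨⟩∘ (⟨⟩-cong project₂ project₁)

  eval-curry : ∀ {Y X A B} (g : X ×ₒ A ⇒ B) (a : Y ⇒ X) (b : Y ⇒ A) →
               eval ∘ ⟨ curry g ∘ a , b ⟩ ≈ g ∘ ⟨ a , b ⟩
  eval-curry g a b = begin
    eval ∘ ⟨ curry g ∘ a , b ⟩                         ≈⟨ ∘-resp-≈ ≈.refl (⟨⟩-cong ≈.refl identityˡ) ⟨
    eval ∘ ⟨ curry g ∘ a , id ∘ b ⟩                    ≈⟨ ∘-resp-≈ ≈.refl ⁂∘⟨⟩ ⟨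
    eval ∘ (⟨ curry g ∘ π₁ , id ∘ π₂ ⟩ ∘ ⟨ a , b ⟩)    ≈⟨ assoc ⟨
    (eval ∘ ⟨ curry g ∘ π₁ , id ∘ π₂ ⟩) ∘ ⟨ a , b ⟩    ≈⟨ ∘-resp-≈ β ≈.refl ⟩
    g ∘ ⟨ a , b ⟩                                      ∎
    where open SetoidReasoning (hom-setoid _ _)

  const : ∀ {A D} → A ⇒ D ⇨ A
  const = curry π₁

  eval-const : ∀ {Y A D} (a : Y ⇒ A) (d : Y ⇒ D) → eval ∘ ⟨ const ∘ a , d ⟩ ≈ a
  eval-const a d = ≈.trans (eval-curry π₁ a d) project₁

  evaluateAt : ∀ {A B} → A ⇒ (A ⇨ B) ⇨ B
  evaluateAt = curry (eval ∘ ⟨ π₂ , π₁ ⟩)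

  eval-evaluateAt : ∀ {Y A B} (a : Y ⇒ A) (φ : Y ⇒ A ⇨ B) →
                    eval ∘ ⟨ evaluateAt ∘ a , φ ⟩ ≈ eval ∘ ⟨ φ , a ⟩
  eval-evaluateAt a φ =
    ≈.trans (eval-curry _ a φ) (≈.trans assoc (∘-resp-≈ ≈.refl swap∘⟨⟩))

  module _ {A} {s : (A ⇨ A) ⇨ A ⇒ A} (canonical∘s≈id : canonical A A ∘ s ≈ id) where

    eval-section : ∀ {Y} (m : Y ⇒ (A ⇨ A) ⇨ A) (φ : Y ⇒ A ⇨ A) →
                   eval ∘ ⟨ m , φ ⟩ ≈ s ∘ m
    eval-section m φ = begin
      eval ∘ ⟨ m , φ ⟩                            ≈⟨ ∘-resp-≈ ≈.refl (⟨⟩-cong m≈canonical∘s∘m ≈.refl) ⟩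
      eval ∘ ⟨ canonical A A ∘ (s ∘ m) , φ ⟩      ≈⟨ eval-const (s ∘ m) φ ⟩
      s ∘ m                                       ∎
      where
        open SetoidReasoning (hom-setoid _ _)
        m≈canonical∘s∘m : m ≈ canonical A A ∘ (s ∘ m)
        m≈canonical∘s∘m = ≈.sym (≈.trans (≈.sym assoc)
          (≈.trans (∘-resp-≈ canonical∘s≈id ≈.refl) identityˡ))

    eval-independent : ∀ {Y} (φ ψ : Y ⇒ A ⇨ A) (a : Y ⇒ A) →
                       eval ∘ ⟨ φ , a ⟩ ≈ eval ∘ ⟨ ψ , a ⟩
    eval-independent φ ψ a = begin
      eval ∘ ⟨ φ , a ⟩                   ≈⟨ eval-evaluateAt a φ ⟨
      eval ∘ ⟨ evaluateAt ∘ a , φ ⟩      ≈⟨ eval-section _ φ ⟩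
      s ∘ (evaluateAt ∘ a)               ≈⟨ eval-section _ ψ ⟨
      eval ∘ ⟨ evaluateAt ∘ a , ψ ⟩      ≈⟨ eval-evaluateAt a ψ ⟩
      eval ∘ ⟨ ψ , a ⟩                   ∎
      where open SetoidReasoning (hom-setoid _ _)

    morphisms-into-unique : ∀ {Y} (f g : Y ⇒ A) → f ≈ g
    morphisms-into-unique f g = begin
      f                                  ≈⟨ eval-const f g ⟨
      eval ∘ ⟨ const ∘ f , g ⟩           ≈⟨ eval-independent _ _ g ⟩
      eval ∘ ⟨ const ∘ g , g ⟩           ≈⟨ eval-const g g ⟩
      g                                  ∎
      where open SetoidReasoning (hom-setoid _ _)

module PreBoolean {o ℓ e} {C : Category o ℓ e}
                  (ccc : CartesianClosed C) (cc : Cocartesian C) where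
  open Category C
  open CartesianClosed ccc
  open Cocartesian cc

  infix 4 _≃_
  _≃_ : Obj → Obj → Set ℓ
  _≃_ = _~_ _⇒_

  ≃-isEquivalence : IsEquivalence _≃_
  ≃-isEquivalence = record
    { refl  = id , id
    ; sym   = λ (f , g) → g , f
    ; trans = λ (f , f′) (g , g′) → g ∘ f , f′ ∘ g′
    }

  ≃-setoid : Setoid o ℓ
  ≃-setoid = record { isEquivalence = ≃-isEquivalence }

  ¬ₒ_ : Obj → Obj
  ¬ₒ A = A ⇨ ⊥ₒ

  apply : ∀ {Z A B} → Z ⇒ A ⇨ B → Z ⇒ A → Z ⇒ B
  apply f a = eval ∘ ⟨ f , a ⟩

  swap : ∀ {A B} → A ×ₒ B ⇒ B ×ₒ A
  swap = ⟨ π₂ , π₁ ⟩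

  ×-+-isLattice : IsLattice _≃_ _+ₒ_ _×ₒ_
  ×-+-isLattice = record
    { isEquivalence = ≃-isEquivalence
    ; ∨-comm  = λ _ _ → [ i₂ , i₁ ] , [ i₂ , i₁ ]
    ; ∨-assoc = λ _ _ _ → [ [ i₁ , i₂ ∘ i₁ ] , i₂ ∘ i₂ ] , [ i₁ ∘ i₁ , [ i₁ ∘ i₂ , i₂ ] ]
    ; ∨-cong  = λ (f , f′) (g , g′) → [ i₁ ∘ f , i₂ ∘ g ] , [ i₁ ∘ f′ , i₂ ∘ g′ ]
    ; ∧-comm  = λ _ _ → swap , swap
    ; ∧-assoc = λ _ _ _ → ⟨ π₁ ∘ π₁ , ⟨ π₂ ∘ π₁ , π₂ ⟩ ⟩ , ⟨ ⟨ π₁ , π₁ ∘ π₂ ⟩ , π₂ ∘ π₂ ⟩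
    ; ∧-cong  = λ (f , f′) (g , g′) → ⟨ f ∘ π₁ , g ∘ π₂ ⟩ , ⟨ f′ ∘ π₁ , g′ ∘ π₂ ⟩
    ; absorptive = (λ _ _ → [ id , π₁ ] , i₁) , (λ _ _ → π₁ , ⟨ id , i₁ ⟩)
    }

  open IsLattice ×-+-isLattice using (∨-cong; ∨-assoc; ∨-comm; ∧-cong; ∧-comm; ∨-absorbs-∧; ∧-absorbs-∨)

  ×-distribˡ-+ : ∀ {X Y Z} → X ×ₒ (Y +ₒ Z) ⇒ (X ×ₒ Y) +ₒ (X ×ₒ Z)
  ×-distribˡ-+ = apply ([ curry (i₁ ∘ swap) , curry (i₂ ∘ swap) ] ∘ π₂) π₁

  ×-+-isDistributiveLattice : IsDistributiveLattice _≃_ _+ₒ_ _×ₒ_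
  ×-+-isDistributiveLattice = record
    { isLattice   = ×-+-isLattice
    ; ∨-distrib-∧ = comm∧distrˡ⇒distr ∧-cong ∨-comm
        (distrib∧absorbs⇒distribˡ ∨-cong ∨-assoc ∧-comm ∨-absorbs-∧ ∧-absorbs-∨ ∧-distrib-∨)
    ; ∧-distrib-∨ = ∧-distrib-∨
    }
    where
      open Consequences ≃-setoid using (comm∧distrˡ⇒distr; distrib∧absorbs⇒distribˡ)
      ∧-distrib-∨ = comm∧distrˡ⇒distr ∨-cong ∧-comm
        (λ _ _ _ → ×-distribˡ-+ , [ ⟨ π₁ , i₁ ∘ π₂ ⟩ , ⟨ π₁ , i₂ ∘ π₂ ⟩ ])

  ¬¬-excluded-middle : ∀ {X} → ¬ₒ (X +ₒ ¬ₒ X) ⇒ ⊥ₒ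
  ¬¬-excluded-middle = apply id (i₂ ∘ curry (apply π₁ (i₁ ∘ π₂)))

  excluded-middle : (∀ {A} → ¬ₒ A ⇨ A ⇒ A) → ∀ {X} → ⊤ₒ ⇒ X +ₒ ¬ₒ X
  excluded-middle ¬A⇒A⇒A = ¬A⇒A⇒A ∘ curry (¡ ∘ ¬¬-excluded-middle ∘ π₂)

  isPreBooleanCategory : (∀ {A} → ¬ₒ A ⇨ A ⇒ A) → IsPreBooleanCategory C
  isPreBooleanCategory ¬A⇒A⇒A = record
    { ≤-refl  = id
    ; ≤-trans = λ f g → g ∘ f
    ; _∨_ = _+ₒ_ ; _∧_ = _×ₒ_ ; ¬_ = ¬ₒ_ ; ⊤ = ⊤ₒ ; ⊥ = ⊥ₒ
    ; isBooleanAlgebra = isBooleanAlgebraʳ record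
        { isDistributiveLattice = ×-+-isDistributiveLattice
        ; ∨-complementʳ = λ _ → ! , excluded-middle ¬A⇒A⇒A
        ; ∧-complementʳ = λ _ → apply π₂ π₁ , ¡
        ; ¬-cong = λ (f , g) → curry (apply π₁ (g ∘ π₂)) , curry (apply π₁ (f ∘ π₂))
        }
    ; order = λ _ _ → mk⇔ (λ f → π₁ , ⟨ id , f ⟩) (λ (_ , g) → π₂ ∘ g)
    }

lemma3p5 : ∀ {o ℓ e} (C : Category o ℓ e) (ccc : CartesianClosed C) →
           (∀ A B → IsIso C (CartesianClosed.canonical ccc A B)) →
           Posetal C × (Cocartesian C → IsPreBooleanCategory C)
lemma3p5 C ccc canonical-iso =
    (λ f g → morphisms-into-unique (proj₂ (proj₂ (canonical-iso _ _))) f g)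
  , λ cc → PreBoolean.isPreBooleanCategory ccc cc
             (proj₁ (canonical-iso _ (Cocartesian.⊥ₒ cc)))
  where open CartesianClosedProperties ccc using (morphisms-into-unique)
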